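{- Let $\mathcal{A}=(\mathcal{P}(AP),Q,I,\delta,F)$ be a $[0,1]$-acceptance automaton and $\mathcal{K}=(W,R,\lambda)$ a Kripke structure, and let $(q_0,s_0)\bullet(q_1,s_1)\bullet\ldots$ be an optimal run of the product $\mathcal{A}\times\mathcal{K}$ (such a run exists). Then the path $s_0s_1\ldots\in\mathrm{path}(\mathcal{K})$ realizes the optimal value of $\mathcal{A}$ over $\mathcal{K}$, that is, $\mathcal{L}(\mathcal{A})(\lambda(s_0)\lambda(s_1)\ldots)=\max_{\xi\in\mathrm{path}(\mathcal{K})}\mathcal{L}(\mathcal{A})(\lambda(\xi))$.
   Context: A $[0,1]$-acceptance automaton is $(\Sigma,Q,I,\delta,F)$ with $\Sigma,Q$ finite, $I\subseteq Q$, $\delta:Q\times\Sigma\to\mathcal{P}(Q)\setminus\{\emptyset\}$, $F:Q\to[0,1]$; runs over $w=a_0a_1\ldots$ are $\rho=q_0a_0q_1a_1\ldots$ with $q_0\in I$, $q_{i+1}\in\delta(q_i,a_i)$; $\mathrm{Inf}(\rho)$ is the set of states occurring infinitely often; $\mathcal{L}(\mathcal{A})(w)=\max\{F(q)\mid\exists\rho\in\mathrm{run}(w).\,q\in\mathrm{Inf}(\rho)\}$. A Kripke structure over a finite set $AP$ is $\mathcal{K}=(W,R,\lambda)$ with $W$ finite, $R\subseteq W^2$ left-total and $\lambda:W\to\mathcal{P}(AP)$; its paths are $\xi=s_0s_1\ldots$ with $(s_i,s_{i+1})\in R$, and $\lambda(\xi)=\lambda(s_0)\lambda(s_1)\ldots$.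 The product $\mathcal{A}\times\mathcal{K}$ is the $[0,1]$-acceptance automaton over the singleton alphabet $\{\bullet\}$ with state set $Q\times W$, initial states $I\times W$, transitions $\delta'((q,s),\bullet)=\{(q',s')\mid q'\in\delta(q,\lambda(s)),(s,s')\in R\}$, and acceptance values $F'(q,s)=F(q)$. An optimal run of $\mathcal{A}\times\mathcal{K}$ is a run $\rho$ over the unique word $\bullet^\omega$ with $\max\{F'(x)\mid x\in\mathrm{Inf}(\rho)\}=\mathcal{L}(\mathcal{A}\times\mathcal{K})(\bullet^\omega)$. -}

module Defs where

open import Level using (0ℓ)
open import Data.Nat using (ℕ; suc; _*_) renaming (_≤_ to _≤ℕ_)
open import Data.Fin using (Fin)
open import Data.Fin.Properties using (*↔×)
open import Data.Fin.Subset using (Subset)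
open import Data.Unit using (⊤; tt)
open import Data.Product using (Σ; ∃; ∃-syntax; _×_; _,_; proj₁; proj₂)
open import Function using (_∘_; _↔_)
open import Function.Properties.Inverse using (↔-sym; ↔-trans)
open import Data.Product.Function.NonDependent.Propositional using (_×-↔_)
open import Relation.Binary.Bundles using (TotalOrder)
open import Relation.Binary.PropositionalEquality using (_≡_)

-- The value domain [0,1] is only used through its (total) order, so the
-- acceptance values are taken in an arbitrary total order T.
module _ (T : TotalOrder 0ℓ 0ℓ 0ℓ) where
  open TotalOrder T renaming (Carrier to V)

  Finite : Set → Set
  Finite A = Σ ℕ λ n → A ↔ Fin n

  record Automaton (Σ' : Set) : Set₁ where
    field
      Q        : Set
      Q-finite : Finite Q
      I        : Q → Set
      δ        : Q → Σ' → Q → Set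
      δ-nonempty : ∀ q a → ∃ λ q' → δ q a q'
      F        : Q → V

  Word : Set → Set
  Word Σ' = ℕ → Σ'

  module _ {Σ' : Set} (A : Automaton Σ') where
    open Automaton A

    IsRun : Word Σ' → (ℕ → Q) → Set
    IsRun w ρ = I (ρ 0) × (∀ i → δ (ρ i) (w i) (ρ (suc i)))

    Inf : (ℕ → Q) → Q → Set
    Inf ρ q = ∀ n → ∃ λ m → n ≤ℕ m × ρ m ≡ q

    RunValue : (ℕ → Q) → V → Set
    RunValue ρ v = (∃ λ q → Inf ρ q × F q ≈ v) × (∀ q → Inf ρ q → F q ≤ v)

    LangValue : Word Σ' → V → Set
    LangValue w v =
      (∃ λ ρ → IsRun w ρ × ∃ λ q → Inf ρ q × F q ≈ v)
      × (∀ ρ → IsRun w ρ → ∀ q → Inf ρ q → F q ≤ v)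

  record Kripke (nAP : ℕ) : Set₁ where
    field
      W        : Set
      W-finite : Finite W
      R        : W → W → Set
      R-total  : ∀ s → ∃ λ s' → R s s'
      lab      : W → Subset nAP

  module _ {nAP : ℕ} (K : Kripke nAP) where
    open Kripke K

    IsPath : (ℕ → W) → Set
    IsPath ξ = ∀ i → R (ξ i) (ξ (suc i))

    labels : (ℕ → W) → Word (Subset nAP)
    labels ξ = lab ∘ ξ

  -- Product A × K over the singleton alphabet {•} = ⊤
  product : {nAP : ℕ} → Automaton (Subset nAP) → Kripke nAP → Automaton ⊤
  product A K = record
    { Q = A.Q × K.W
    ; Q-finite = (proj₁ A.Q-finite * proj₁ K.W-finite)
               , ↔-trans (proj₂ A.Q-finite ×-↔ proj₂ K.W-finite) (↔-sym *↔×)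
    ; I = λ { (q , s) → A.I q }
    ; δ = λ { (q , s) _ (q' , s') → A.δ q (K.lab s) q' × K.R s s' }
    ; δ-nonempty = λ { (q , s) _ →
        let (q' , d) = A.δ-nonempty q (K.lab s) ; (s' , r) = K.R-total s
        in (q' , s') , d , r }
    ; F = λ { (q , s) → A.F q }
    }
    where
      module A = Automaton A
      module K = Kripke K

  bullets : Word ⊤
  bullets _ = tt

  IsOptimalRun : {nAP : ℕ} (A : Automaton (Subset nAP)) (K : Kripke nAP)
               → (ℕ → Automaton.Q A × Kripke.W K) → Set
  IsOptimalRun A K ρ =
    IsRun (product A K) bullets ρ
    × ∃ λ v → RunValue (product A K) ρ v × LangValue (product A K) bullets v

  MaxOverPaths : {nAP : ℕ} (A : Automaton (Subset nAP)) (K : Kripke nAP) → V → Set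
  MaxOverPaths A K v =
    (∃ λ ξ → IsPath K ξ × LangValue A (labels K ξ) v)
    × (∀ ξ → IsPath K ξ → ∀ u → LangValue A (labels K ξ) u → u ≤ v)

-- A run of A over the labels of a path ξ that visits q infinitely often can
-- be turned into a lasso-shaped run of A × K: since W is finite, q occurs at
-- two positions i < j with ξ i = ξ j, and repeating the segment [i, j) forever
-- yields a run of the product visiting (q, ξ i) infinitely often. Optimality
-- of ρ therefore bounds F q for every such q, while projecting ρ itself gives
-- a path on which the optimal value is attained.
module Submission where

open import Defs
open import Level using (0ℓ)
open import Data.Nat using (ℕ; zero; suc; z≤n; _≤_; _<_; _+_; _<?_)
open import Data.Nat.Properties
  using (≤-antisym; ≮⇒≥; <⇒≱; <⇒≤; <-trans; ≤-<-trans; n<1+n; m≤m+n; +-suc; m<1+n⇒m<n∨m≡n)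
open import Data.Fin using (Fin; toℕ)
open import Data.Fin.Properties using (pigeonhole)
open import Data.Fin.Subset using (Subset)
open import Data.Product using (∃; ∃₂; _×_; _,_; proj₁; proj₂)
open import Data.Sum using (_⊎_; inj₁; inj₂)
open import Data.Unit using (⊤; tt)
open import Function using (_∘_; _↔_; Inverse; Injection)
open import Function.Properties.Inverse using (↔⇒↣)
open import Relation.Binary.Bundles using (TotalOrder)
open import Relation.Binary.PropositionalEquality
  using (_≡_; refl; sym; trans; cong; cong₂; subst)
open import Relation.Nullary using (yes; no; contradiction)

-- Inf T A ρ q unfolds to InfinitelyOften ρ q.
InfinitelyOften : {X : Set} → (ℕ → X) → X → Set
InfinitelyOften x a = ∀ n → ∃ λ m → n ≤ m × x m ≡ a

infinitelyOften-map : {X Y : Set} (f : X → Y) {x : ℕ → X} {a : X} →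
                      InfinitelyOften x a → InfinitelyOften (f ∘ x) (f a)
infinitelyOften-map f often n with m , n≤m , hit ← often n = m , n≤m , cong f hit

module _ {X : Set} {x : ℕ → X} {a : X} (often : InfinitelyOften x a) where

  occurrence : ℕ → ℕ
  occurrence zero    = proj₁ (often 0)
  occurrence (suc k) = proj₁ (often (suc (occurrence k)))

  occurrence-hit : ∀ k → x (occurrence k) ≡ a
  occurrence-hit zero    = proj₂ (proj₂ (often 0))
  occurrence-hit (suc k) = proj₂ (proj₂ (often (suc (occurrence k))))

  occurrence-<-suc : ∀ k → occurrence k < occurrence (suc k)
  occurrence-<-suc k = proj₁ (proj₂ (often (suc (occurrence k))))

  occurrence-mono-< : ∀ {k l} → k < l → occurrence k < occurrence l
  occurrence-mono-< {k} {suc l} k<1+l with m<1+n⇒m<n∨m≡n k<1+l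
  ... | inj₁ k<l  = <-trans (occurrence-mono-< k<l) (occurrence-<-suc l)
  ... | inj₂ refl = occurrence-<-suc k

sequence-pigeonhole : {Y : Set} {n : ℕ} → Y ↔ Fin n → (y : ℕ → Y) →
                      ∃₂ λ k l → k < l × y k ≡ y l
sequence-pigeonhole {n = n} Y↔Fin y
  with k , l , k<l , same ← pigeonhole (n<1+n n) (Inverse.to Y↔Fin ∘ y ∘ toℕ)
  = toℕ k , toℕ l , k<l , Injection.injective (↔⇒↣ Y↔Fin) same

infinitelyOften-repeatsWith : {X Y : Set} {n : ℕ} → Y ↔ Fin n →
                              {x : ℕ → X} {a : X} → InfinitelyOften x a → (y : ℕ → Y) →
                              ∃₂ λ i j → i < j × x i ≡ a × (x i , y i) ≡ (x j , y j)
infinitelyOften-repeatsWith Y↔Fin often y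
  with k , l , k<l , same ← sequence-pigeonhole Y↔Fin (y ∘ occurrence often)
  = occurrence often k , occurrence often l , occurrence-mono-< often k<l , occurrence-hit often k
  , cong₂ _,_ (trans (occurrence-hit often k) (sym (occurrence-hit often l))) same

module Lasso {i j : ℕ} (i<j : i < j) where

  next : ℕ → ℕ
  next k with suc k <? j
  ... | yes _ = suc k
  ... | no  _ = i

  lasso : ℕ → ℕ
  lasso zero    = zero
  lasso (suc k) = next (lasso k)

  lasso-< : ∀ k → lasso k < j
  lasso-< zero    = ≤-<-trans z≤n i<j
  lasso-< (suc k) with suc (lasso k) <? j
  ... | yes k+1<j = k+1<j
  ... | no  _     = i<j

  lasso-suc : ∀ k → lasso (suc k) ≡ suc (lasso k) ⊎ (lasso (suc k) ≡ i × suc (lasso k) ≡ j)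
  lasso-suc k with suc (lasso k) <? j
  ... | yes _     = inj₁ refl
  ... | no  k+1≮j = inj₂ (refl , ≤-antisym (lasso-< k) (≮⇒≥ k+1≮j))

  lasso-returns-within : ∀ d k → j ≤ d + lasso k → ∃ λ m → k < m × lasso m ≡ i
  lasso-returns-within zero    k j≤ = contradiction j≤ (<⇒≱ (lasso-< k))
  lasso-returns-within (suc d) k j≤ with lasso-suc k
  ... | inj₂ (back , _) = suc k , n<1+n k , back
  ... | inj₁ forward
    with m , k+1<m , back ← lasso-returns-within d (suc k)
           (subst (j ≤_) (trans (sym (+-suc d (lasso k))) (cong (d +_) (sym forward))) j≤)
    = m , <-trans (n<1+n k) k+1<m , back

  lasso-returns : ∀ n → ∃ λ m → n ≤ m × lasso m ≡ i
  lasso-returns n with m , n<m , back ← lasso-returns-within j n (m≤m+n j (lasso n))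
    = m , <⇒≤ n<m , back

  module _ {X : Set} (S : X → X → Set) {x : ℕ → X} (steps : ∀ k → S (x k) (x (suc k)))
           (loop : x i ≡ x j) where

    lasso-steps : ∀ k → S (x (lasso k)) (x (lasso (suc k)))
    lasso-steps k with lasso-suc k
    ... | inj₁ forward      = subst (S (x (lasso k)) ∘ x) (sym forward) (steps (lasso k))
    ... | inj₂ (back , end) =
      subst (S (x (lasso k))) (trans (cong x end) (trans (sym loop) (cong x (sym back))))
            (steps (lasso k))

    lasso-infinitelyOften : InfinitelyOften (x ∘ lasso) (x i)
    lasso-infinitelyOften = infinitelyOften-map x lasso-returns

module _ (T : TotalOrder 0ℓ 0ℓ 0ℓ) {nAP : ℕ} (A : Automaton T (Subset nAP)) (K : Kripke T nAP) where
  open TotalOrder T using () renaming (_≤_ to _⊑_)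
  private
    module A = Automaton A
    module K = Kripke K

  A×K : Automaton T ⊤
  A×K = product T A K

  productRun⇒path : ∀ {σ} → IsRun T A×K (bullets T) σ → IsPath T K (proj₂ ∘ σ)
  productRun⇒path (_ , steps) k = proj₂ (steps k)

  productRun⇒run : ∀ {σ} → IsRun T A×K (bullets T) σ → IsRun T A (labels T K (proj₂ ∘ σ)) (proj₁ ∘ σ)
  productRun⇒run (initial , steps) = initial , proj₁ ∘ steps

  lassoProductRun : ∀ {ξ ρ q} → IsPath T K ξ → IsRun T A (labels T K ξ) ρ → Inf T A ρ q →
                    ∃ λ σ → IsRun T A×K (bullets T) σ × ∃ λ s → Inf T A×K σ (q , s)
  lassoProductRun {ξ} {ρ} path (initial , steps) often
    with i , j , i<j , hit , loop ← infinitelyOften-repeatsWith (proj₂ K.W-finite) often ξ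
    = x ∘ lasso
    , (initial , lasso-steps Step x-steps loop)
    , ξ i
    , subst (InfinitelyOften (x ∘ lasso)) (cong (_, ξ i) hit) (lasso-infinitelyOften Step x-steps loop)
    where
    open Lasso i<j
    x : ℕ → A.Q × K.W
    x k = ρ k , ξ k
    Step : A.Q × K.W → A.Q × K.W → Set
    Step p p′ = Automaton.δ A×K p tt p′
    x-steps : ∀ k → Step (x k) (x (suc k))
    x-steps k = steps k , path k

  optimum-bounds-paths : ∀ {v} → LangValue T A×K (bullets T) v →
                         ∀ {ξ ρ q} → IsPath T K ξ → IsRun T A (labels T K ξ) ρ → Inf T A ρ q →
                         A.F q ⊑ v
  optimum-bounds-paths (_ , upper) {q = q} path run often
    with σ , σ-run , s , σ-often ← lassoProductRun path run often
    = upper σ σ-run (q , s) σ-often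

lemma4p12 : (T : TotalOrder 0ℓ 0ℓ 0ℓ) {nAP : ℕ}
    (A : Automaton T (Subset nAP)) (K : Kripke T nAP)
    (ρ : ℕ → Automaton.Q A × Kripke.W K)
    → IsOptimalRun T A K ρ
    → IsPath T K (proj₂ ∘ ρ)
      × ∃ λ v → LangValue T A (labels T K (proj₂ ∘ ρ)) v × MaxOverPaths T A K v
lemma4p12 T A K ρ (run , v , (((q , _) , often , Fq≈v) , _) , optimal) =
  path , v , attained , (proj₂ ∘ ρ , path , attained) , maximal
  where
  open TotalOrder T using (≤-respˡ-≈) renaming (_≤_ to _⊑_)

  path : IsPath T K (proj₂ ∘ ρ)
  path = productRun⇒path T A K run

  attained : LangValue T A (labels T K (proj₂ ∘ ρ)) v
  attained = (proj₁ ∘ ρ , productRun⇒run T A K run , q , infinitelyOften-map proj₁ often , Fq≈v)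
           , λ _ run′ _ often′ → optimum-bounds-paths T A K optimal path run′ often′

  maximal : ∀ ξ → IsPath T K ξ → ∀ u → LangValue T A (labels T K ξ) u → u ⊑ v
  maximal _ ξ-path _ ((_ , run′ , _ , often′ , Fq′≈u) , _) =
    ≤-respˡ-≈ Fq′≈u (optimum-bounds-paths T A K optimal ξ-path run′ often′)
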